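{- There is a function $N:\mathbb{Z}_{>0}\to\mathbb{Z}_{>0}$ such that for all positive integers $n,d$, every partition $\bm\lambda=(\lambda_1,\dots)\vdash n$ with $\bm\lambda\ge_{\mathrm{lex}}(n-2d,1^{2d})$ and every tableau $\tau_{\bm\lambda}$ of shape $\bm\lambda$, each of the following has at most $N(d)$ elements: (i) the set of distinct polynomials $\operatorname{sym}_{\mathrm{hook}(\tau_{\bm\lambda})}(\mathsf{x}^m)$, as $\mathsf{x}^m$ ranges over square-free monomials of degree at most $d$; (ii) the family $\mathsf{g}_F^{\Theta_{\tau_{\bm\lambda}}}$ indexed by pairs $(T,F)$ with $T$ an intersection type of size $n-\lambda_1$ and $F\in\mathcal{F}_T^{2d}$; (iii) the family $\mathsf{d}_F^{\Theta_{\tau_{\bm\lambda}}}$ indexed by the same pairs.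
   Context: Variables $\mathsf{x}_{ij}$, $1\le i<j\le n$ ($\mathsf{x}_{ji}:=\mathsf{x}_{ij}$), polynomials taken modulo $\langle\mathsf{x}_{ij}^2-\mathsf{x}_{ij}\rangle$; $\mathfrak{S}_n$ acts via $\sigma\cdot\mathsf{x}_{ij}=\mathsf{x}_{\sigma(i)\sigma(j)}$. $\ge_{\mathrm{lex}}$ is lexicographic order; $(n-2d,1^{2d})$ is $n-2d$ followed by $2d$ ones. A tableau of shape $\bm\lambda$ is a bijective filling of the Young diagram with $1,\dots,n$; the row group $\mathfrak{R}_\tau$ consists of permutations preserving each row's label set; $\operatorname{sym}_\tau(\mathsf{q}):=\frac1{|\mathfrak{R}_\tau|}\sum_{\sigma\in\mathfrak{R}_\tau}\sigma\cdot\mathsf{q}$. $\mathrm{hook}(\tau_{\bm\lambda})$ is the tableau of shape $(\lambda_1,1^{n-\lambda_1})$ with the same first row as $\tau_{\bm\lambda}$ and remaining labels in the single-box rows in increasing order. $\Theta_{\tau_{\bm\lambda}}\in\mathrm{Inj}([n-\lambda_1],[n])$ sends $i$ to the $i$-th smallest label not in the first row of $\tau_{\bm\lambda}$. Flags: for $0\le t\le f\le n$, an intersection type $T$ of size $t$ is a simple graph on $[t]$; a $T$-flag of size $f$ is a simple graph on $f$ vertices, $t$ of which carry labels $1,\dots,t$ and induce $T$; $\mathcal{F}_T^f$ = such flags up to label-preserving isomorphism (empty if $f>n$ or $t>f$). For $\Theta\in\mathrm{Inj}([t],[n])$, $\mathsf{g}_F^\Theta:=\sum_{h}\prod_{\{u,v\}\in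 E(F)}\mathsf{x}_{h(u)h(v)}$ over injective $h:V(F)\to[n]$ with $h(\text{vertex labeled }i)=\Theta(i)$. With a fixed vertex set $V_f$ (labeled $1,\dots,t$, unlabeled $v_{t+1},\dots,v_f$), $\mathcal{F}^f_{\ge T}$ = all simple graphs on $V_f$ whose labeled part contains $E(T)$, and for $F$ in it $\mathsf{d}_F^\Theta:=\sum_{F'\in\mathcal{F}^f_{\ge T},E(F')\supseteq E(F)}(-1)^{|E(F')|-|E(F)|}\mathsf{g}_{F'}^\Theta$ (for $F\in\mathcal{F}_T^f$ use any representative on $V_f$). -}

module Defs where

open import Data.Nat as ℕ using (ℕ; zero; suc; _≤_; _<_; _∸_; _<ᵇ_; _≤ᵇ_)
open import Data.Nat.Properties using (m∸n≤m; _<?_)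
open import Data.Bool using (Bool; true; false; if_then_else_; not; _∧_; _∨_)
open import Data.Fin as Fin using (Fin; toℕ; inject≤; fromℕ<)
open import Data.Fin.Permutation using (Permutation′; _⟨$⟩ʳ_)
open import Data.List as List using (List; []; _∷_; map; filterᵇ; concatMap; allFin; length; concat)
open import Data.Bool.ListAction using (all; any)
open import Data.Nat.ListAction using (sum)
open import Data.List.Relation.Unary.All using (All)
open import Data.List.Relation.Unary.Any using (Any)
open import Data.List.Relation.Unary.Linked using (Linked)
open import Data.List.Relation.Unary.Unique.Propositional using (Unique)
open import Data.Vec as Vec using (Vec; lookup)
open import Data.Integer using (+_)
open import Data.Rational as ℚ using (ℚ; 0ℚ; 1ℚ)
open import Data.Product using (Σ; _×_; _,_)
open import Data.Sum using (_⊎_)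
open import Data.Unit using (⊤)
open import Relation.Nullary using (yes; no; does)
open import Relation.Binary.PropositionalEquality using (_≡_)

ℚsum : List ℚ → ℚ
ℚsum = List.foldr ℚ._+_ 0ℚ

ℚprod : List ℚ → ℚ
ℚprod = List.foldr ℚ._*_ 1ℚ

avg : List ℚ → ℚ
avg []       = 0ℚ
avg (q ∷ qs) = ℚsum (q ∷ qs) ℚ.* (+ 1 ℚ./ suc (length qs))

negOnePow : ℕ → ℚ
negOnePow zero    = 1ℚ
negOnePow (suc k) = ℚ.- negOnePow k

vecsOver : {A : Set} → List A → (k : ℕ) → List (Vec A k)
vecsOver xs zero    = Vec.[] ∷ []
vecsOver xs (suc k) = concatMap (λ x → map (x Vec.∷_) (vecsOver xs k)) xs

elemᵇ : {n : ℕ} → Fin n → List (Fin n) → Bool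
elemᵇ x xs = any (λ y → does (x Fin.≟ y)) xs

distinctᵇ : {n : ℕ} → List (Fin n) → Bool
distinctᵇ []       = true
distinctᵇ (x ∷ xs) = not (elemᵇ x xs) ∧ distinctᵇ xs

injections : (k n : ℕ) → List (Vec (Fin n) k)
injections k n = filterᵇ (λ v → distinctᵇ (Vec.toList v)) (vecsOver (allFin n) k)

permutations : (n : ℕ) → List (Vec (Fin n) n)
permutations n = injections n n

-- We identify ℚ[x_ij]/⟨x_ij² - x_ij⟩ with the ℚ-valued functions on the
-- Boolean cube {0,1}^{edges of K_n}: a polynomial is given by its
-- evaluation function, and two polynomials are equal iff they agree at
-- every 0/1 point.  A 0/1 point is given by a : Fin n → Fin n → Bool,
-- of which only the entries a i j with i < j are read.

Assignment : ℕ → Set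
Assignment n = Fin n → Fin n → Bool

Poly : ℕ → Set
Poly n = Assignment n → ℚ

_≈ₚ_ : {n : ℕ} → Poly n → Poly n → Set
p ≈ₚ q = ∀ a → p a ≡ q a

-- value of the unordered pair {i,j} at a point (x_ji := x_ij)
canon : {n : ℕ} → Assignment n → Fin n → Fin n → Bool
canon a i j = if toℕ i ≤ᵇ toℕ j then a i j else a j i

var : {n : ℕ} → Fin n → Fin n → Poly n
var i j a = if canon a i j then 1ℚ else 0ℚ

monomial : {n : ℕ} → List (Fin n × Fin n) → Poly n
monomial es a = ℚprod (map (λ { (i , j) → var i j a }) es)

-- σ · q, where σ · x_ij = x_{σ(i) σ(j)} (σ given as a vector of images)
act : {n : ℕ} → Vec (Fin n) n → Poly n → Poly n
act σ q a = q (λ i j → canon a (lookup σ i) (lookup σ j))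

SqFreeMonomial : {n : ℕ} → ℕ → List (Fin n × Fin n) → Set
SqFreeMonomial d es =
  All (λ { (i , j) → i Fin.< j }) es × Unique es × length es ≤ d

IsPartition : ℕ → List ℕ → Set
IsPartition n lam = All (0 <_) lam × Linked ℕ._≥_ lam × sum lam ≡ n

-- lexicographic ≥ on sequences, both padded by zeros
_≥lex_ : List ℕ → List ℕ → Set
[]       ≥lex []       = ⊤
[]       ≥lex (y ∷ ys) = y ≡ 0 × ([] ≥lex ys)
(x ∷ xs) ≥lex []       = (0 < x) ⊎ (x ≡ 0 × (xs ≥lex []))
(x ∷ xs) ≥lex (y ∷ ys) = (y < x) ⊎ (x ≡ y × (xs ≥lex ys))

-- (n - 2d, 1^{2d})  (with truncated subtraction)
hookShape : ℕ → ℕ → List ℕ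
hookShape n d = (n ∸ 2 ℕ.* d) ∷ List.replicate (2 ℕ.* d) 1

part₁ : List ℕ → ℕ
part₁ []      = 0
part₁ (k ∷ _) = k

-- a tableau of shape lam: rows of labels with the prescribed lengths,
-- all labels distinct (together with sum lam ≡ n: a bijective filling)
record Tableau (n : ℕ) (lam : List ℕ) : Set where
  field
    rows     : List (List (Fin n))
    shape    : map length rows ≡ lam
    distinct : Unique (concat rows)
open Tableau public

rowGroup : {n : ℕ} → List (List (Fin n)) → List (Vec (Fin n) n)
rowGroup rs = filterᵇ
  (λ σ → all (λ r → all (λ i → elemᵇ (lookup σ i) r) r) rs)
  (permutations _)

sym : {n : ℕ} → List (List (Fin n)) → Poly n → Poly n
sym rs q a = avg (map (λ σ → act σ q a) (rowGroup rs))

firstRow : {n : ℕ} → List (List (Fin n)) → List (Fin n)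
firstRow []      = []
firstRow (r ∷ _) = r

others : {n : ℕ} → List (List (Fin n)) → List (Fin n)
others rs = filterᵇ (λ i → not (elemᵇ i (firstRow rs))) (allFin _)

hookRows : {n : ℕ} → List (List (Fin n)) → List (List (Fin n))
hookRows []        = []
hookRows (r ∷ rs)  = r ∷ map (λ i → i ∷ []) (others (r ∷ rs))

-- Θ_τ : [n - λ₁] → [n], i ↦ i-th smallest label outside the first row.
-- (The fallback branch is never used for a genuine tableau of shape lam.)
Θ : {n : ℕ} {lam : List ℕ} → Tableau n lam → Fin (n ∸ part₁ lam) → Fin n
Θ {n} {lam} τ i with toℕ i <? length (others (rows τ))
... | yes p = List.lookup (others (rows τ)) (fromℕ< p)
... | no _  = inject≤ i (m∸n≤m n (part₁ lam))

Graph : ℕ → Set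
Graph f = Vec (Vec Bool f) f

adj : {f : ℕ} → Graph f → Fin f → Fin f → Bool
adj G u v = lookup (lookup G u) v

IsSimple : {f : ℕ} → Graph f → Set
IsSimple G = (∀ u → adj G u u ≡ false) × (∀ u v → adj G u v ≡ adj G v u)

isSimpleᵇ : {f : ℕ} → Graph f → Bool
isSimpleᵇ {f} G = all (λ u → not (adj G u u) ∧
  all (λ v → does (Data.Bool._≟_ (adj G u v) (adj G v u))) (allFin f)) (allFin f)
  where import Data.Bool

edgesOf : {f : ℕ} → Graph f → List (Fin f × Fin f)
edgesOf {f} G = concatMap (λ u → map (λ v → u , v)
  (filterᵇ (λ v → (toℕ u <ᵇ toℕ v) ∧ adj G u v) (allFin f))) (allFin f)

simpleGraphs : (f : ℕ) → List (Graph f)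
simpleGraphs f = filterᵇ isSimpleᵇ (vecsOver (vecsOver (false ∷ true ∷ []) f) f)

subgraphᵇ : {f : ℕ} → Graph f → Graph f → Bool
subgraphᵇ {f} G H = all (λ u → all (λ v → not (adj G u v) ∨ adj H u v) (allFin f)) (allFin f)

-- Index set of the families in (ii),(iii): pairs (T,F), T an intersection
-- type (simple graph) on [t], F a T-flag of size f on the vertex set V_f
-- = [f], whose vertices inject≤ i (i < t) carry the labels.
-- F_T^f is empty unless t ≤ f ≤ n.
record FlagPair (n t f : ℕ) : Set where
  field
    f≤n      : f ≤ n
    t≤f      : t ≤ f
    T        : Graph t
    T-simple : IsSimple T
    F        : Graph f
    F-simple : IsSimple F
    F-labels : ∀ i j → adj F (inject≤ i t≤f) (inject≤ j t≤f) ≡ adj T i j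
open FlagPair public

-- same index: equal T and label-preserving isomorphic flags
_≈flag_ : {n t f : ℕ} → FlagPair n t f → FlagPair n t f → Set
_≈flag_ {n} {t} {f} p q =
  T p ≡ T q ×
  Σ (Permutation′ f) λ π →
    (∀ i → π ⟨$⟩ʳ inject≤ i (t≤f p) ≡ inject≤ i (t≤f p)) ×
    (∀ u v → adj (F q) (π ⟨$⟩ʳ u) (π ⟨$⟩ʳ v) ≡ adj (F p) u v)

labeledInjections : {n t f : ℕ} → (Fin t → Fin n) → .(t ≤ f) → List (Vec (Fin n) f)
labeledInjections {n} {t} {f} Θ' t≤f' = filterᵇ
  (λ h → all (λ i → does (lookup h (inject≤ i t≤f') Fin.≟ Θ' i)) (allFin t))
  (injections f n)

gGraph : {n t f : ℕ} → (Fin t → Fin n) → .(t ≤ f) → Graph f → Poly n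
gGraph Θ' t≤f' G a = ℚsum (map
  (λ h → monomial (map (λ { (u , v) → lookup h u , lookup h v }) (edgesOf G)) a)
  (labeledInjections Θ' t≤f'))

gPoly : {n t f : ℕ} → (Fin t → Fin n) → FlagPair n t f → Poly n
gPoly Θ' p = gGraph Θ' (t≤f p) (F p)

aboveType : {t f : ℕ} → .(t ≤ f) → Graph t → List (Graph f)
aboveType {t} {f} t≤f' T' = filterᵇ
  (λ G → all (λ i → all (λ j → not (adj T' i j) ∨ adj G (inject≤ i t≤f') (inject≤ j t≤f'))
    (allFin t)) (allFin t))
  (simpleGraphs f)

dPoly : {n t f : ℕ} → (Fin t → Fin n) → FlagPair n t f → Poly n
dPoly Θ' p a = ℚsum (map
  (λ G → negOnePow (length (edgesOf G) ∸ length (edgesOf (F p))) ℚ.* gGraph Θ' (t≤f p) G a)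
  (filterᵇ (subgraphᵇ (F p)) (aboveType (t≤f p) (T p))))

SymSetAtMost : {n : ℕ} → ℕ → List (List (Fin n)) → ℕ → Set
SymSetAtMost {n} k rs d =
  Σ (List (Poly n)) λ Ps → length Ps ≤ k ×
    (∀ es → SqFreeMonomial d es → Any (λ P → sym (hookRows rs) (monomial es) ≈ₚ P) Ps)

-- (ii),(iii): the family (fam p) indexed by pairs p has ≤ k members,
-- i.e. at most k indices (T,F) up to label-preserving isomorphism of F
-- (each index class listed together with its member)
FamilyAtMost : {n t f : ℕ} → ℕ → (FlagPair n t f → Poly n) → Set
FamilyAtMost {n} {t} {f} k fam =
  Σ (List (FlagPair n t f)) λ L → length L ≤ k ×
    (∀ p → Any (λ q → p ≈flag q × fam p ≈ₚ fam q) L)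

{-# OPTIONS --safe #-}

-- Write r for the first row of τ; since λ ≥lex (n - 2d, 1^{2d}), at most 2d labels lie outside r.
-- The row group of hook(τ) contains every transposition of two labels of r, and such relabellings
-- do not change sym_hook(τ).  A monomial of degree ≤ d has at most 2d endpoint labels, so any
-- endpoint in r beyond the first 2d entries of r can be swapped onto an unused one of those entries.
-- Hence every polynomial in (i) is sym_hook(τ)(x^m′) for a monomial x^m′ of degree ≤ d whose
-- endpoints lie in a fixed set of ≤ 4d labels, which leaves at most 1 + 16d² + … + (16d²)^d of them.
-- In (ii) and (iii), g_F and d_F depend only on the graphs T and F, and a T-flag of size 2d is
-- determined by its graph on 2d vertices, of which there are at most 2^{4d²}.
module Submission where

open import Defs
open import Data.Nat using (ℕ; _≤_; _∸_; _*_)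
open import Data.List using (List)
open import Data.Product using (Σ; _×_)

open import Data.Bool using (Bool; true; false; not; T?; if_then_else_) renaming (T to IsTrue)
open import Data.Bool.Properties using (T-∧) renaming (_≟_ to _≟ᵇ_)
open import Data.Fin using (Fin; zero; suc; toℕ; inject≤)
open import Data.Fin.Properties using (_≟_; toℕ-injective; injective⇒≤; all?)
import Data.Fin.Permutation as Permutation
import Data.Fin.Permutation.Components as PC
open import Data.Integer using (+_)
open import Data.List
  using ([]; _∷_; [_]; _++_; length; map; filter; filterᵇ; concatMap; take; allFin;
         cartesianProductWith; cartesianProduct; mapMaybe)
import Data.List as List
open import Data.List.Membership.Propositional using (_∈_; _∉_; find; lose)
open import Data.List.Membership.Propositional.Properties
  using (∈-lookup; ∈-map⁺; ∈-map⁻; ∈-++⁺ˡ; ∈-++⁺ʳ; ∈-filter⁺; ∈-filter⁻; ∈-allFin;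
         ∈-cartesianProductWith⁺; ∈-cartesianProduct⁺)
open import Data.List.Membership.Propositional.Properties.WithK using (unique∧set⇒bag)
open import Data.List.Membership.Setoid.Properties using (index-injective)
import Data.List.Membership.DecPropositional as DecMembership
open import Data.List.Properties
  using (length-map; length-++; length-tabulate; length-take; length-catMaybes; map-∘; map-cong)
open import Data.List.Relation.Binary.BagAndSetEquality using (∼bag⇒↭)
open import Data.List.Relation.Binary.Permutation.Propositional using (_↭_; ↭⇒↭ₛ)
open import Data.List.Relation.Binary.Permutation.Propositional.Properties using (↭-length)
  renaming (map⁺ to ↭-map⁺)
open import Data.List.Relation.Binary.Permutation.Setoid.Properties using (foldr-commMonoid)
open import Data.List.Relation.Unary.All as All using (All; []; _∷_)
open import Data.List.Relation.Unary.All.Properties using (all⁺; all⁻; ¬Any⇒All¬; All¬⇒¬Any)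
  renaming (++⁻ˡ to All-++⁻ˡ)
open import Data.List.Relation.Unary.Any as Any using (Any; here; there; any?)
open import Data.List.Relation.Unary.Any.Properties using (mapMaybe⁺) renaming (map⁺ to Any-map⁺)
open import Data.List.Relation.Unary.Unique.Propositional using (Unique; []; _∷_)
import Data.List.Relation.Unary.Unique.Propositional.Properties as Unique
open import Data.Maybe using (Maybe; just; nothing)
import Data.Maybe.Relation.Unary.Any as MaybeAny
open import Data.Nat using (zero; suc; _+_; _^_; _<_; _≤ᵇ_; z≤n; s≤s; s≤s⁻¹)
open import Data.Nat.Properties
  using (module ≤-Reasoning; ≤-refl; ≤-reflexive; ≤-trans; ≤-antisym; <-≤-trans; <⇒≤; <⇒≱; ≰⇒≥;
         ≤ᵇ-reflects-≤; _≤?_; m≤m+n; m≤n+m; m≤n+m∸n; m⊓n≤m; +-mono-≤; +-monoʳ-≤; +-cancelʳ-≤;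
         *-mono-≤; *-monoʳ-≤; *-suc; *-distribʳ-+; n<1+n; suc-injective; m≤n⇒m≤1+n)
open import Data.Product using (_,_; proj₂; ∃; ∃₂)
import Data.Product as Product
open import Data.Rational as ℚ using (ℚ)
open import Data.Rational.Properties using (+-0-isCommutativeMonoid)
open import Data.Sum using (_⊎_; inj₁; inj₂)
open import Data.Vec as Vec using (Vec; lookup; tabulate; toList)
open import Data.Vec.Properties using (lookup-map; lookup∘tabulate; tabulate∘lookup; ∷-injective)
open import Data.Vec.Relation.Binary.Pointwise.Extensional using (ext; Pointwise-≡⇒≡)
import Data.Vec.Relation.Unary.All.Properties as VecAll
import Data.Vec.Relation.Unary.AllPairs as VecAllPairs
import Data.Vec.Relation.Unary.Unique.Propositional as VecUnique
import Data.Vec.Relation.Unary.Unique.Propositional.Properties as VecUnique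
open import Function using (_∘_; _⇔_; mk⇔; Equivalence; Injective)
open import Level using (0ℓ)
open import Relation.Binary using (_Preserves_⟶_)
open import Relation.Binary.PropositionalEquality
  using (_≡_; _≢_; refl; trans; cong; cong₂; subst; setoid; module ≡-Reasoning)
import Relation.Binary.PropositionalEquality as ≡
open import Relation.Nullary using (¬_; Dec; yes; no; does; contradiction; ¬?)
open import Relation.Nullary.Decidable using (dec-true; dec-false; _×-dec_; decidable-stable)
open import Relation.Nullary.Reflects using (ofʸ; ofⁿ)
open import Relation.Unary using (Pred; Decidable)

module _ {A : Set} where

  Unique-++⁻ˡ : ∀ xs {ys : List A} → Unique (xs ++ ys) → Unique xs
  Unique-++⁻ˡ []       _          = []
  Unique-++⁻ˡ (x ∷ xs) (x∉ys ∷ u) = All-++⁻ˡ xs x∉ys ∷ Unique-++⁻ˡ xs u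

  Unique-lookup-injective : ∀ {xs : List A} → Unique xs → Injective _≡_ _≡_ (List.lookup xs)
  Unique-lookup-injective (x∉xs ∷ u) {zero}  {zero}  _  = refl
  Unique-lookup-injective (x∉xs ∷ u) {zero}  {suc j} eq = contradiction eq (All.lookup x∉xs (∈-lookup j))
  Unique-lookup-injective (x∉xs ∷ u) {suc i} {zero}  eq =
    contradiction (≡.sym eq) (All.lookup x∉xs (∈-lookup i))
  Unique-lookup-injective (x∉xs ∷ u) {suc i} {suc j} eq = cong suc (Unique-lookup-injective u eq)

  Unique-⊆⇒length≤ : ∀ {xs ys : List A} → Unique xs → (∀ {x} → x ∈ xs → x ∈ ys) → length xs ≤ length ys
  Unique-⊆⇒length≤ {xs} u xs⊆ys = injective⇒≤ position-injective
    where
    position : Fin (length xs) → Fin _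
    position i = Any.index (xs⊆ys (∈-lookup i))
    position-injective : Injective _≡_ _≡_ position
    position-injective eq =
      Unique-lookup-injective u (index-injective (setoid A) (xs⊆ys (∈-lookup _)) (xs⊆ys (∈-lookup _)) eq)

  Unique-⇔⇒↭ : ∀ {xs ys : List A} → Unique xs → Unique ys → (∀ {x} → x ∈ xs ⇔ x ∈ ys) → xs ↭ ys
  Unique-⇔⇒↭ u v same = ∼bag⇒↭ (unique∧set⇒bag u v same)

  ∈-take : ∀ k {xs : List A} {x} → x ∈ take k xs → x ∈ xs
  ∈-take (suc k) {_ ∷ _} (here refl) = here refl
  ∈-take (suc k) {_ ∷ _} (there x∈)  = there (∈-take k x∈)

  length-take-∉ : ∀ k {xs : List A} {v} → v ∈ xs → v ∉ take k xs → length (take k xs) ≡ k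
  length-take-∉ zero    _           _  = refl
  length-take-∉ (suc k) (here refl) v∉ = contradiction (here refl) v∉
  length-take-∉ (suc k) (there v∈)  v∉ = cong suc (length-take-∉ k v∈ (v∉ ∘ there))

  module _ {P : Pred A 0ℓ} (P? : Decidable P) (f : A → A) where

    length-filter-map≤ : ∀ xs → (∀ {x} → x ∈ xs → P (f x) → P x) →
                         length (filter P? (map f xs)) ≤ length (filter P? xs)
    length-filter-map≤ []       _ = z≤n
    length-filter-map≤ (x ∷ xs) reflects with P? (f x) | P? x
    ... | yes _   | yes _  = s≤s (length-filter-map≤ xs (reflects ∘ there))
    ... | yes Pfx | no ¬Px = contradiction (reflects (here refl) Pfx) ¬Px
    ... | no _    | yes _  = m≤n⇒m≤1+n (length-filter-map≤ xs (reflects ∘ there))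
    ... | no _    | no _   = length-filter-map≤ xs (reflects ∘ there)

    length-filter-map< : ∀ xs → (∀ {x} → x ∈ xs → P (f x) → P x) → ∀ {v} → v ∈ xs → P v → ¬ P (f v) →
                         length (filter P? (map f xs)) < length (filter P? xs)
    length-filter-map< (x ∷ xs) reflects (here refl) Pv ¬Pfv with P? (f x) | P? x
    ... | yes Pfx | _      = contradiction Pfx ¬Pfv
    ... | no _    | yes _  = s≤s (length-filter-map≤ xs (reflects ∘ there))
    ... | no _    | no ¬Px = contradiction Pv ¬Px
    length-filter-map< (x ∷ xs) reflects (there v∈) Pv ¬Pfv with P? (f x) | P? x
    ... | yes _   | yes _  = s≤s (length-filter-map< xs (reflects ∘ there) v∈ Pv ¬Pfv)
    ... | yes Pfx | no ¬Px = contradiction (reflects (here refl) Pfx) ¬Px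
    ... | no _    | yes _  = m≤n⇒m≤1+n (length-filter-map< xs (reflects ∘ there) v∈ Pv ¬Pfv)
    ... | no _    | no _   = length-filter-map< xs (reflects ∘ there) v∈ Pv ¬Pfv

ℚsum-↭ : ℚsum Preserves _↭_ ⟶ _≡_
ℚsum-↭ p = foldr-commMonoid (setoid ℚ) +-0-isCommutativeMonoid (↭⇒↭ₛ p)

avg-↭ : avg Preserves _↭_ ⟶ _≡_
avg-↭ {[]}     {[]}     _ = refl
avg-↭ {[]}     {_ ∷ _}  p = contradiction (↭-length p) λ ()
avg-↭ {_ ∷ _}  {[]}     p = contradiction (↭-length p) λ ()
avg-↭ {_ ∷ _}  {_ ∷ _}  p = cong₂ (λ s k → s ℚ.* (+ 1 ℚ./ suc k)) (ℚsum-↭ p) (suc-injective (↭-length p))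

module _ {A B C : Set} (f : A → B → C) where

  concatMap-map≡cartesianProductWith : ∀ xs ys →
    concatMap (λ x → map (f x) ys) xs ≡ cartesianProductWith f xs ys
  concatMap-map≡cartesianProductWith []       ys = refl
  concatMap-map≡cartesianProductWith (x ∷ xs) ys =
    cong (map (f x) ys ++_) (concatMap-map≡cartesianProductWith xs ys)

  length-cartesianProductWith : ∀ xs ys → length (cartesianProductWith f xs ys) ≡ length xs * length ys
  length-cartesianProductWith []       ys = refl
  length-cartesianProductWith (x ∷ xs) ys = begin
    length (map (f x) ys ++ cartesianProductWith f xs ys)         ≡⟨ length-++ (map (f x) ys) ⟩
    length (map (f x) ys) + length (cartesianProductWith f xs ys) ≡⟨ cong₂ _+_ (length-map (f x) ys)
                                                                         (length-cartesianProductWith xs ys) ⟩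
    length ys + length xs * length ys                             ∎
    where open ≡-Reasoning

module _ {A : Set} where

  vecsOver-suc : ∀ (xs : List A) k →
                 vecsOver xs (suc k) ≡ cartesianProductWith Vec._∷_ xs (vecsOver xs k)
  vecsOver-suc xs k = concatMap-map≡cartesianProductWith Vec._∷_ xs (vecsOver xs k)

  ∈-vecsOver : ∀ {xs : List A} → (∀ x → x ∈ xs) → ∀ {k} (v : Vec A k) → v ∈ vecsOver xs k
  ∈-vecsOver         _    Vec.[]              = here refl
  ∈-vecsOver {xs} all∈xs {suc k} (x Vec.∷ v) rewrite vecsOver-suc xs k =
    ∈-cartesianProductWith⁺ Vec._∷_ (all∈xs x) (∈-vecsOver all∈xs v)

  vecsOver-unique : ∀ {xs : List A} → Unique xs → ∀ k → Unique (vecsOver xs k)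
  vecsOver-unique     u zero    = [] ∷ []
  vecsOver-unique {xs} u (suc k) rewrite vecsOver-suc xs k =
    Unique.cartesianProductWith⁺ Vec._∷_ ∷-injective u (vecsOver-unique u k)

  length-vecsOver : ∀ (xs : List A) k → length (vecsOver xs k) ≡ length xs ^ k
  length-vecsOver xs zero    = refl
  length-vecsOver xs (suc k) rewrite vecsOver-suc xs k =
    trans (length-cartesianProductWith Vec._∷_ xs (vecsOver xs k))
          (cong (length xs *_) (length-vecsOver xs k))

  listsOfLength≤ : ℕ → List A → List (List A)
  listsOfLength≤ zero    xs = [ [] ]
  listsOfLength≤ (suc d) xs = [] ∷ cartesianProductWith _∷_ xs (listsOfLength≤ d xs)

  ∈-listsOfLength≤ : ∀ {d xs} {es : List A} → length es ≤ d → All (_∈ xs) es → es ∈ listsOfLength≤ d xs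
  ∈-listsOfLength≤ {zero}  {es = []}    _         _            = here refl
  ∈-listsOfLength≤ {suc d} {es = []}    _         _            = here refl
  ∈-listsOfLength≤ {suc d} {es = e ∷ es} (s≤s es≤d) (e∈ ∷ es∈) =
    there (∈-cartesianProductWith⁺ _∷_ e∈ (∈-listsOfLength≤ es≤d es∈))

geometricSum : ℕ → ℕ → ℕ
geometricSum m zero    = 1
geometricSum m (suc d) = suc (m * geometricSum m d)

length-listsOfLength≤ : ∀ {A : Set} d (xs : List A) →
                        length (listsOfLength≤ d xs) ≡ geometricSum (length xs) d
length-listsOfLength≤ zero    xs = refl
length-listsOfLength≤ (suc d) xs =
  cong suc (trans (length-cartesianProductWith _∷_ xs (listsOfLength≤ d xs))
                  (cong (length xs *_) (length-listsOfLength≤ d xs)))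

geometricSum-monoˡ : ∀ {m m′} d → m ≤ m′ → geometricSum m d ≤ geometricSum m′ d
geometricSum-monoˡ zero    _     = ≤-refl
geometricSum-monoˡ (suc d) m≤m′ = s≤s (*-mono-≤ m≤m′ (geometricSum-monoˡ d m≤m′))

geometricSum-positive : ∀ m d → 1 ≤ geometricSum m d
geometricSum-positive m zero    = ≤-refl
geometricSum-positive m (suc d) = s≤s z≤n

T-not⇒¬T : ∀ {b} → IsTrue (not b) → ¬ IsTrue b
T-not⇒¬T {false} _ ()

¬T⇒T-not : ∀ {b} → ¬ IsTrue b → IsTrue (not b)
¬T⇒T-not {true}  ¬b = ¬b _
¬T⇒T-not {false} _  = _

module _ {A : Set} (p : A → Bool) where

  ∈-filterᵇ⁻ : ∀ {xs x} → x ∈ filterᵇ p xs → x ∈ xs × IsTrue (p x)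
  ∈-filterᵇ⁻ = ∈-filter⁻ (T? ∘ p)

  ∈-filterᵇ⁺ : ∀ {xs x} → x ∈ xs → IsTrue (p x) → x ∈ filterᵇ p xs
  ∈-filterᵇ⁺ = ∈-filter⁺ (T? ∘ p)

module _ {n : ℕ} where

  elemᵇ⇒∈ : ∀ {x : Fin n} {xs} → IsTrue (elemᵇ x xs) → x ∈ xs
  elemᵇ⇒∈ {x} {y ∷ ys} h with x ≟ y
  ... | yes x≡y = here x≡y
  ... | no _    = there (elemᵇ⇒∈ h)

  ∈⇒elemᵇ : ∀ {x : Fin n} {xs} → x ∈ xs → IsTrue (elemᵇ x xs)
  ∈⇒elemᵇ {x} {y ∷ ys} x∈ with x ≟ y | x∈
  ... | yes _  | _            = _
  ... | no x≢y | here x≡y     = contradiction x≡y x≢y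
  ... | no _   | there x∈ys   = ∈⇒elemᵇ x∈ys

  distinctᵇ⇒Unique : ∀ {xs : List (Fin n)} → IsTrue (distinctᵇ xs) → Unique xs
  distinctᵇ⇒Unique {[]}     _ = []
  distinctᵇ⇒Unique {x ∷ xs} h =
    let x∉xs , xs-distinct = Equivalence.to T-∧ h
    in ¬Any⇒All¬ xs (T-not⇒¬T x∉xs ∘ ∈⇒elemᵇ) ∷ distinctᵇ⇒Unique xs-distinct

  Unique⇒distinctᵇ : ∀ {xs : List (Fin n)} → Unique xs → IsTrue (distinctᵇ xs)
  Unique⇒distinctᵇ []            = _
  Unique⇒distinctᵇ (x∉xs ∷ u) =
    Equivalence.from T-∧ (¬T⇒T-not (All¬⇒¬Any x∉xs ∘ elemᵇ⇒∈) , Unique⇒distinctᵇ u)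

-- Permutations and row groups

module _ {A : Set} where

  Vec-ext : ∀ {k} {u v : Vec A k} → (∀ i → lookup u i ≡ lookup v i) → u ≡ v
  Vec-ext eq = Pointwise-≡⇒≡ (ext eq)

  Unique-toList⁻ : ∀ {k} {v : Vec A k} → Unique (toList v) → VecUnique.Unique v
  Unique-toList⁻ {v = Vec.[]}    []          = VecAllPairs.[]
  Unique-toList⁻ {v = x Vec.∷ v} (x∉v ∷ u) = VecAll.toList⁻ x∉v VecAllPairs.∷ Unique-toList⁻ u

  Unique-toList⁺ : ∀ {k} {v : Vec A k} → VecUnique.Unique v → Unique (toList v)
  Unique-toList⁺ VecAllPairs.[]            = []
  Unique-toList⁺ (x∉v VecAllPairs.∷ u) = VecAll.toList⁺ x∉v ∷ Unique-toList⁺ u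

  Unique-toList⇒injective : ∀ {k} (v : Vec A k) → Unique (toList v) → Injective _≡_ _≡_ (lookup v)
  Unique-toList⇒injective v u = VecUnique.lookup-injective (Unique-toList⁻ u) _ _

  injective⇒Unique-toList : ∀ {k} (v : Vec A k) → Injective _≡_ _≡_ (lookup v) → Unique (toList v)
  injective⇒Unique-toList v inj =
    subst (Unique ∘ toList) (tabulate∘lookup v) (Unique-toList⁺ (VecUnique.tabulate⁺ inj))

module _ {n : ℕ} where

  infixr 9 _∘ₚ_
  _∘ₚ_ : Vec (Fin n) n → Vec (Fin n) n → Vec (Fin n) n
  σ ∘ₚ π = Vec.map (lookup σ) π

  lookup-∘ₚ : ∀ σ π i → lookup (σ ∘ₚ π) i ≡ lookup σ (lookup π i)
  lookup-∘ₚ σ π i = lookup-map i (lookup σ) π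

  ∘ₚ-cancelʳ : ∀ {π ρ} → (∀ i → lookup π (lookup ρ i) ≡ i) → ∀ σ → (σ ∘ₚ π) ∘ₚ ρ ≡ σ
  ∘ₚ-cancelʳ {π} {ρ} πρ≗id σ = Vec-ext λ i → begin
    lookup ((σ ∘ₚ π) ∘ₚ ρ) i      ≡⟨ lookup-∘ₚ (σ ∘ₚ π) ρ i ⟩
    lookup (σ ∘ₚ π) (lookup ρ i)  ≡⟨ lookup-∘ₚ σ π (lookup ρ i) ⟩
    lookup σ (lookup π (lookup ρ i)) ≡⟨ cong (lookup σ) (πρ≗id i) ⟩
    lookup σ i                    ∎
    where open ≡-Reasoning

  PreservesRows : List (List (Fin n)) → Vec (Fin n) n → Set
  PreservesRows rs σ = ∀ {r} → r ∈ rs → ∀ {i} → i ∈ r → lookup σ i ∈ r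

  ∈-permutations⁺ : ∀ {σ} → Injective _≡_ _≡_ (lookup σ) → σ ∈ permutations n
  ∈-permutations⁺ {σ} inj =
    ∈-filterᵇ⁺ _ (∈-vecsOver ∈-allFin σ) (Unique⇒distinctᵇ (injective⇒Unique-toList σ inj))

  ∈-permutations⁻ : ∀ {σ} → σ ∈ permutations n → Injective _≡_ _≡_ (lookup σ)
  ∈-permutations⁻ {σ} σ∈ = Unique-toList⇒injective σ (distinctᵇ⇒Unique σ-distinct)
    where σ-distinct = proj₂ (∈-filterᵇ⁻ (distinctᵇ ∘ toList) {vecsOver (allFin n) n} σ∈)

  ∈-rowGroup⁺ : ∀ {rs σ} → Injective _≡_ _≡_ (lookup σ) → PreservesRows rs σ → σ ∈ rowGroup rs
  ∈-rowGroup⁺ inj preserves = ∈-filterᵇ⁺ _ (∈-permutations⁺ inj)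
    (all⁻ _ (All.tabulate λ r∈ → all⁻ _ (All.tabulate λ i∈ → ∈⇒elemᵇ (preserves r∈ i∈))))

  ∈-rowGroup⁻ : ∀ {rs σ} → σ ∈ rowGroup rs → Injective _≡_ _≡_ (lookup σ) × PreservesRows rs σ
  ∈-rowGroup⁻ {rs} σ∈ =
    let σ∈perms , preserves = ∈-filterᵇ⁻ _ σ∈
    in ∈-permutations⁻ σ∈perms ,
       λ r∈ i∈ → elemᵇ⇒∈ (All.lookup (all⁺ _ _ (All.lookup (all⁺ _ rs preserves) r∈)) i∈)

  rowGroup-unique : ∀ rs → Unique (rowGroup rs)
  rowGroup-unique rs = Unique.filter⁺ _ (Unique.filter⁺ _ (vecsOver-unique (Unique.allFin⁺ n) n))

  rowGroup-∘ₚ : ∀ {rs σ π} → σ ∈ rowGroup rs → π ∈ rowGroup rs → σ ∘ₚ π ∈ rowGroup rs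
  rowGroup-∘ₚ {rs} {σ} {π} σ∈ π∈ =
    let σ-injective , σ-preserves = ∈-rowGroup⁻ {rs} σ∈
        π-injective , π-preserves = ∈-rowGroup⁻ {rs} π∈
    in ∈-rowGroup⁺ {rs}
         (λ eq → π-injective (σ-injective (trans (≡.sym (lookup-∘ₚ σ π _)) (trans eq (lookup-∘ₚ σ π _)))))
         (λ r∈ i∈ → subst (_∈ _) (≡.sym (lookup-∘ₚ σ π _)) (σ-preserves r∈ (π-preserves r∈ i∈)))

  map-∘ₚ-rowGroup↭ : ∀ {rs π π⁻¹} → π ∈ rowGroup rs → π⁻¹ ∈ rowGroup rs →
                     (∀ i → lookup π (lookup π⁻¹ i) ≡ i) → (∀ i → lookup π⁻¹ (lookup π i) ≡ i) →
                     map (_∘ₚ π) (rowGroup rs) ↭ rowGroup rs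
  map-∘ₚ-rowGroup↭ {rs} {π} {π⁻¹} π∈ π⁻¹∈ ππ⁻¹≗id π⁻¹π≗id =
    Unique-⇔⇒↭ (Unique.map⁺ ∘ₚπ-injective (rowGroup-unique rs)) (rowGroup-unique rs) (mk⇔ to from)
    where
    ∘ₚπ-injective : ∀ {σ τ} → σ ∘ₚ π ≡ τ ∘ₚ π → σ ≡ τ
    ∘ₚπ-injective {σ} {τ} eq =
      trans (≡.sym (∘ₚ-cancelʳ {π} ππ⁻¹≗id σ)) (trans (cong (_∘ₚ π⁻¹) eq) (∘ₚ-cancelʳ {π} ππ⁻¹≗id τ))
    to : ∀ {σ} → σ ∈ map (_∘ₚ π) (rowGroup rs) → σ ∈ rowGroup rs
    to σ∈ with ∈-map⁻ (_∘ₚ π) σ∈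
    ... | τ , τ∈ , refl = rowGroup-∘ₚ {rs} τ∈ π∈
    from : ∀ {σ} → σ ∈ rowGroup rs → σ ∈ map (_∘ₚ π) (rowGroup rs)
    from {σ} σ∈ = subst (_∈ _) (∘ₚ-cancelʳ {π⁻¹} π⁻¹π≗id σ) (∈-map⁺ (_∘ₚ π) (rowGroup-∘ₚ {rs} σ∈ π⁻¹∈))

-- Relabelling monomials

module _ {n : ℕ} where

  canon-sym : ∀ (a : Assignment n) i j → canon a i j ≡ canon a j i
  canon-sym a i j
    with toℕ i ≤ᵇ toℕ j | ≤ᵇ-reflects-≤ (toℕ i) (toℕ j) | toℕ j ≤ᵇ toℕ i | ≤ᵇ-reflects-≤ (toℕ j) (toℕ i)
  ... | true  | ofʸ i≤j | true  | ofʸ j≤i = cong₂ a i≡j (≡.sym i≡j)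
    where i≡j = toℕ-injective (≤-antisym i≤j j≤i)
  ... | true  | _       | false | _       = refl
  ... | false | _       | true  | _       = refl
  ... | false | ofⁿ i≰j | false | ofⁿ j≰i = contradiction (≰⇒≥ i≰j) j≰i

  canon-reindex : ∀ (a : Assignment n) (f : Fin n → Fin n) i j →
                canon (λ x y → canon a (f x) (f y)) i j ≡ canon a (f i) (f j)
  canon-reindex a f i j with toℕ i ≤ᵇ toℕ j
  ... | true  = refl
  ... | false = canon-sym a (f j) (f i)

  relabel : Vec (Fin n) n → List (Fin n × Fin n) → List (Fin n × Fin n)
  relabel σ = map (Product.map (lookup σ) (lookup σ))

  monomial-act : ∀ σ es → act σ (monomial es) ≈ₚ monomial (relabel σ es)
  monomial-act σ []             a = refl
  monomial-act σ ((i , j) ∷ es) a =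
    cong₂ ℚ._*_ (cong (λ b → if b then ℚ.1ℚ else ℚ.0ℚ) (canon-reindex a (lookup σ) i j))
                (monomial-act σ es a)

  relabel-∘ₚ : ∀ σ π es → relabel σ (relabel π es) ≡ relabel (σ ∘ₚ π) es
  relabel-∘ₚ σ π []             = refl
  relabel-∘ₚ σ π ((i , j) ∷ es) =
    cong₂ _∷_ (≡.sym (cong₂ _,_ (lookup-∘ₚ σ π i) (lookup-∘ₚ σ π j))) (relabel-∘ₚ σ π es)

  act-relabel : ∀ σ π es → act σ (monomial (relabel π es)) ≈ₚ act (σ ∘ₚ π) (monomial es)
  act-relabel σ π es a = begin
    act σ (monomial (relabel π es)) a     ≡⟨ monomial-act σ (relabel π es) a ⟩
    monomial (relabel σ (relabel π es)) a ≡⟨ cong (λ es′ → monomial es′ a) (relabel-∘ₚ σ π es) ⟩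
    monomial (relabel (σ ∘ₚ π) es) a      ≡⟨ monomial-act (σ ∘ₚ π) es a ⟨
    act (σ ∘ₚ π) (monomial es) a          ∎
    where open ≡-Reasoning

  sym-relabel : ∀ rs {π π⁻¹} → π ∈ rowGroup rs → π⁻¹ ∈ rowGroup rs →
                (∀ i → lookup π (lookup π⁻¹ i) ≡ i) → (∀ i → lookup π⁻¹ (lookup π i) ≡ i) →
                ∀ es → sym rs (monomial (relabel π es)) ≈ₚ sym rs (monomial es)
  sym-relabel rs {π} π∈ π⁻¹∈ ππ⁻¹≗id π⁻¹π≗id es a = begin
    avg (map (λ σ → act σ (monomial (relabel π es)) a) G)   ≡⟨ cong avg (map-cong (λ σ → act-relabel σ π es a) G) ⟩
    avg (map (λ σ → act (σ ∘ₚ π) (monomial es) a) G)        ≡⟨ cong avg (map-∘ G) ⟩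
    avg (map (λ σ → act σ (monomial es) a) (map (_∘ₚ π) G)) ≡⟨ avg-↭ (↭-map⁺ _ G∘π↭G) ⟩
    avg (map (λ σ → act σ (monomial es) a) G)               ∎
    where
    open ≡-Reasoning
    G = rowGroup rs
    G∘π↭G = map-∘ₚ-rowGroup↭ {rs = rs} π∈ π⁻¹∈ ππ⁻¹≗id π⁻¹π≗id

  transposition : Fin n → Fin n → Vec (Fin n) n
  transposition v w = tabulate (PC.transpose v w)

  lookup-transposition : ∀ v w x → lookup (transposition v w) x ≡ PC.transpose v w x
  lookup-transposition v w = lookup∘tabulate (PC.transpose v w)

  transposition-inverse : ∀ v w i → lookup (transposition v w) (lookup (transposition w v) i) ≡ i
  transposition-inverse v w i = begin
    lookup (transposition v w) (lookup (transposition w v) i) ≡⟨ lookup-transposition v w _ ⟩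
    PC.transpose v w (lookup (transposition w v) i)           ≡⟨ cong (PC.transpose v w)
                                                                     (lookup-transposition w v i) ⟩
    PC.transpose v w (PC.transpose w v i)                     ≡⟨ PC.transpose-inverse v w ⟩
    i                                                         ∎
    where open ≡-Reasoning

  transposition-injective : ∀ v w → Injective _≡_ _≡_ (lookup (transposition v w))
  transposition-injective v w {i} {j} eq = begin
    i                                                         ≡⟨ transposition-inverse w v i ⟨
    lookup (transposition w v) (lookup (transposition v w) i) ≡⟨ cong (lookup (transposition w v)) eq ⟩
    lookup (transposition w v) (lookup (transposition v w) j) ≡⟨ transposition-inverse w v j ⟩
    j                                                         ∎
    where open ≡-Reasoning

  transpose-cases : ∀ (v w x : Fin n) →
                    PC.transpose v w x ≡ w ⊎ PC.transpose v w x ≡ v ⊎ PC.transpose v w x ≡ x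
  transpose-cases v w x with does (x ≟ v)
  ... | true  = inj₁ refl
  ... | false with does (x ≟ w)
  ...   | true  = inj₂ (inj₁ refl)
  ...   | false = inj₂ (inj₂ refl)

  transpose-matchˡ : ∀ (v w : Fin n) → PC.transpose v w v ≡ w
  transpose-matchˡ v w rewrite dec-true (v ≟ v) refl = refl

  transpose-fixes : ∀ {v w x : Fin n} → x ≢ v → x ≢ w → PC.transpose v w x ≡ x
  transpose-fixes {v} {w} {x} x≢v x≢w rewrite dec-false (x ≟ v) x≢v | dec-false (x ≟ w) x≢w = refl

  ends : List (Fin n × Fin n) → List (Fin n)
  ends []             = []
  ends ((i , j) ∷ es) = i ∷ j ∷ ends es

  length-ends : ∀ es → length (ends es) ≡ 2 * length es
  length-ends []       = refl
  length-ends (_ ∷ es) = trans (cong (λ m → suc (suc m)) (length-ends es)) (≡.sym (*-suc 2 (length es)))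

  ends-relabel : ∀ σ es → ends (relabel σ es) ≡ map (lookup σ) (ends es)
  ends-relabel σ []             = refl
  ends-relabel σ ((i , j) ∷ es) = cong (λ xs → lookup σ i ∷ lookup σ j ∷ xs) (ends-relabel σ es)

  ∈-ends : ∀ {i j es} → (i , j) ∈ es → i ∈ ends es × j ∈ ends es
  ∈-ends {es = _ ∷ _} (here refl) = here refl , there (here refl)
  ∈-ends {es = _ ∷ _} (there e∈)  = Product.map (there ∘ there) (there ∘ there) (∈-ends e∈)

-- The row group of hook(τ)

module _ {n : ℕ} (r : List (Fin n)) (rest : List (List (Fin n))) where

  ∈-others⁻ : ∀ {o} → o ∈ others (r ∷ rest) → o ∉ r
  ∈-others⁻ o∈ = T-not⇒¬T (proj₂ (∈-filterᵇ⁻ (λ i → not (elemᵇ i r)) {allFin n} o∈)) ∘ ∈⇒elemᵇ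

  ∉⇒∈-others : ∀ {o} → o ∉ r → o ∈ others (r ∷ rest)
  ∉⇒∈-others o∉ = ∈-filterᵇ⁺ _ (∈-allFin _) (¬T⇒T-not (o∉ ∘ elemᵇ⇒∈))

  length-others+length≤ : Unique r → length (others (r ∷ rest)) + length r ≤ n
  length-others+length≤ r-unique = begin
    length (others (r ∷ rest)) + length r ≡⟨ length-++ (others (r ∷ rest)) ⟨
    length (others (r ∷ rest) ++ r)      ≤⟨ Unique-⊆⇒length≤ others++r-unique (λ {x} _ → ∈-allFin x) ⟩
    length (allFin n)                    ≡⟨ length-tabulate (λ i → i) ⟩
    n                                    ∎
    where
    open ≤-Reasoning
    others++r-unique : Unique (others (r ∷ rest) ++ r)
    others++r-unique = Unique.++⁺ (Unique.filter⁺ _ (Unique.allFin⁺ n)) r-unique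
                                  (λ (o∈others , o∈r) → ∈-others⁻ o∈others o∈r)

  transposition∈hookRowGroup : ∀ {v w} → v ∈ r → w ∈ r →
                               transposition v w ∈ rowGroup (hookRows (r ∷ rest))
  transposition∈hookRowGroup {v} {w} v∈r w∈r = ∈-rowGroup⁺ (transposition-injective v w) preserves
    where
    preserves : PreservesRows (hookRows (r ∷ rest)) (transposition v w)
    preserves (here refl) {i} i∈r rewrite lookup-transposition v w i with transpose-cases v w i
    ... | inj₁ ≡w        = subst (_∈ r) (≡.sym ≡w) w∈r
    ... | inj₂ (inj₁ ≡v) = subst (_∈ r) (≡.sym ≡v) v∈r
    ... | inj₂ (inj₂ ≡i) = subst (_∈ r) (≡.sym ≡i) i∈r
    preserves (there row∈) i∈row with ∈-map⁻ (λ o → o ∷ []) row∈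
    ... | o , o∈others , refl with i∈row
    ... | here refl = here (trans (lookup-transposition v w o) (transpose-fixes o≢v o≢w))
      where
      o≢v : o ≢ v
      o≢v refl = ∈-others⁻ o∈others v∈r
      o≢w : o ≢ w
      o≢w refl = ∈-others⁻ o∈others w∈r

symBound : ℕ → ℕ
symBound d = geometricSum (4 * d * (4 * d)) d

module HookCanonicalForm {n : ℕ} (d : ℕ) (r : List (Fin n)) (rest : List (List (Fin n)))
                         (r-unique : Unique r) where

  open DecMembership (_≟_ {n}) using (_∈?_)

  private
    H : List (List (Fin n))
    H = hookRows (r ∷ rest)

  _≈ₕ_ : List (Fin n × Fin n) → List (Fin n × Fin n) → Set
  es ≈ₕ es′ = sym H (monomial es) ≈ₚ sym H (monomial es′)

  slots : List (Fin n)
  slots = take (2 * d) r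

  support : List (Fin n)
  support = others (r ∷ rest) ++ slots

  outside? : Decidable (_∉ support)
  outside? x = ¬? (x ∈? support)

  outsideCount : List (Fin n × Fin n) → ℕ
  outsideCount es = length (filter outside? (ends es))

  candidates : List (List (Fin n × Fin n))
  candidates = listsOfLength≤ d (cartesianProduct support support)

  ∉support⇒∈r : ∀ {x} → x ∉ support → x ∈ r
  ∉support⇒∈r {x} x∉ = decidable-stable (x ∈? r) (x∉ ∘ ∈-++⁺ˡ ∘ ∉⇒∈-others r rest)

  freeSlot : ∀ {es v} → length es ≤ d → v ∈ ends es → v ∉ support → ∃ λ w → w ∈ slots × w ∉ ends es
  freeSlot {es} {v} es≤d v∈ends v∉support with any? (λ w → ¬? (w ∈? ends es)) slots
  ... | yes some-free = find some-free
  ... | no  none-free = contradiction (Unique-⊆⇒length≤ v∷slots-unique v∷slots⊆ends) (<⇒≱ ends<v∷slots)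
    where
    v∉slots : v ∉ slots
    v∉slots = v∉support ∘ ∈-++⁺ʳ (others (r ∷ rest))
    v∷slots-unique : Unique (v ∷ slots)
    v∷slots-unique = ¬Any⇒All¬ slots v∉slots ∷ Unique.take⁺ (2 * d) r-unique
    v∷slots⊆ends : ∀ {x} → x ∈ v ∷ slots → x ∈ ends es
    v∷slots⊆ends (here refl)     = v∈ends
    v∷slots⊆ends {x} (there x∈) = decidable-stable (x ∈? ends es) (none-free ∘ lose x∈)
    ends<v∷slots : length (ends es) < length (v ∷ slots)
    ends<v∷slots = begin-strict
      length (ends es)    ≡⟨ length-ends es ⟩
      2 * length es       ≤⟨ *-monoʳ-≤ 2 es≤d ⟩
      2 * d               <⟨ n<1+n (2 * d) ⟩
      suc (2 * d)         ≡⟨ cong suc (length-take-∉ (2 * d) (∉support⇒∈r v∉support) v∉slots) ⟨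
      length (v ∷ slots)  ∎
      where open ≤-Reasoning

  fewerOutside : ∀ {es v} → length es ≤ d → v ∈ ends es → v ∉ support →
                 ∃ λ es′ → length es′ ≡ length es × outsideCount es′ < outsideCount es × es′ ≈ₕ es
  fewerOutside {es} {v} es≤d v∈ends v∉support with freeSlot es≤d v∈ends v∉support
  ... | w , w∈slots , w∉ends =
    relabel τ es , length-map _ es , fewer ,
    sym-relabel H (transposition∈hookRowGroup r rest v∈r w∈r) (transposition∈hookRowGroup r rest w∈r v∈r)
                (transposition-inverse v w) (transposition-inverse w v) es
    where
    τ = transposition v w
    v∈r : v ∈ r
    v∈r = ∉support⇒∈r v∉support
    w∈r : w ∈ r
    w∈r = ∈-take (2 * d) w∈slots
    w∈support : w ∈ support
    w∈support = ∈-++⁺ʳ (others (r ∷ rest)) w∈slots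
    keepsInside : ∀ {x} → x ∈ ends es → lookup τ x ∉ support → x ∉ support
    keepsInside {x} x∈ends τx∉ with x ≟ v | x ≟ w
    ... | yes refl | _        = v∉support
    ... | no _     | yes refl = contradiction x∈ends w∉ends
    ... | no x≢v   | no x≢w   =
      subst (_∉ support) (trans (lookup-transposition v w x) (transpose-fixes x≢v x≢w)) τx∉
    τv∈support : lookup τ v ∈ support
    τv∈support = subst (_∈ support) (≡.sym (trans (lookup-transposition v w v) (transpose-matchˡ v w)))
                       w∈support
    fewer : outsideCount (relabel τ es) < outsideCount es
    fewer = subst (λ xs → length (filter outside? xs) < outsideCount es) (≡.sym (ends-relabel τ es))
                  (length-filter-map< outside? (lookup τ) (ends es) keepsInside v∈ends v∉support
                                      (λ τv∉ → τv∉ τv∈support))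

  canonicalise : ∀ k es → outsideCount es < k → length es ≤ d → Any (es ≈ₕ_) candidates
  canonicalise (suc k) es count<k es≤d with any? outside? (ends es)
  ... | no none-outside = Any.map (λ { refl a → refl }) (∈-listsOfLength≤ es≤d (All.tabulate inside))
    where
    inside : ∀ {e} → e ∈ es → e ∈ cartesianProduct support support
    inside {i , j} e∈ =
      let i∈ , j∈ = ∈-ends e∈
      in ∈-cartesianProduct⁺ (decidable-stable (i ∈? support) (none-outside ∘ lose i∈))
                             (decidable-stable (j ∈? support) (none-outside ∘ lose j∈))
  ... | yes some-outside with find some-outside
  ... | v , v∈ends , v∉support with fewerOutside es≤d v∈ends v∉support
  ... | es′ , same-length , fewer , es′≈es =
    Any.map (λ es′≈ a → trans (≡.sym (es′≈es a)) (es′≈ a))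
            (canonicalise k es′ (<-≤-trans fewer (s≤s⁻¹ count<k))
                                (subst (_≤ d) (≡.sym same-length) es≤d))

  symSetAtMost : SymSetAtMost (length candidates) (r ∷ rest) d
  symSetAtMost =
    map (sym H ∘ monomial) candidates , ≤-reflexive (length-map _ candidates) ,
    λ es (_ , _ , es≤d) → Any-map⁺ (canonicalise (suc (outsideCount es)) es ≤-refl es≤d)

  length-candidates≤ : length (others (r ∷ rest)) ≤ 2 * d → length candidates ≤ symBound d
  length-candidates≤ others≤2d = begin
    length candidates
      ≡⟨ length-listsOfLength≤ d _ ⟩
    geometricSum (length (cartesianProduct support support)) d
      ≡⟨ cong (λ m → geometricSum m d) (length-cartesianProductWith _,_ support support) ⟩
    geometricSum (length support * length support) d
      ≤⟨ geometricSum-monoˡ d (*-mono-≤ support≤4d support≤4d) ⟩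
    symBound d
      ∎
    where
    open ≤-Reasoning
    slots≤2d : length slots ≤ 2 * d
    slots≤2d = ≤-trans (≤-reflexive (length-take (2 * d) r)) (m⊓n≤m _ _)
    support≤4d : length support ≤ 4 * d
    support≤4d = begin
      length support                            ≡⟨ length-++ (others (r ∷ rest)) ⟩
      length (others (r ∷ rest)) + length slots ≤⟨ +-mono-≤ others≤2d slots≤2d ⟩
      2 * d + 2 * d                             ≡⟨ *-distribʳ-+ d 2 2 ⟨
      4 * d                                     ∎

SymSetAtMost-mono : ∀ {n k k′} {rs : List (List (Fin n))} {d} →
                    k ≤ k′ → SymSetAtMost k rs d → SymSetAtMost k′ rs d
SymSetAtMost-mono k≤k′ (Ps , Ps≤k , covers) = Ps , ≤-trans Ps≤k k≤k′ , covers

hookSym-atMost : ∀ {n} d (r : List (Fin n)) rest → Unique r → n ≤ 2 * d + length r →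
                 SymSetAtMost (symBound d) (r ∷ rest) d
hookSym-atMost {n} d r rest r-unique n≤2d+r =
  SymSetAtMost-mono {rs = r ∷ rest} (length-candidates≤ others≤2d) symSetAtMost
  where
  open HookCanonicalForm d r rest r-unique
  others≤2d : length (others (r ∷ rest)) ≤ 2 * d
  others≤2d = +-cancelʳ-≤ (length r) _ _ (≤-trans (length-others+length≤ r rest r-unique) n≤2d+r)

-- Flags

Graph-ext : ∀ {k} {G G′ : Graph k} → (∀ u v → adj G u v ≡ adj G′ u v) → G ≡ G′
Graph-ext same = Vec-ext λ u → Vec-ext λ v → same u v

allGraphs : (f : ℕ) → List (Graph f)
allGraphs f = vecsOver (vecsOver (false ∷ true ∷ []) f) f

∈-allGraphs : ∀ {f} (G : Graph f) → G ∈ allGraphs f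
∈-allGraphs = ∈-vecsOver (∈-vecsOver λ { false → here refl ; true → there (here refl) })

length-allGraphs : ∀ f → length (allGraphs f) ≡ (2 ^ f) ^ f
length-allGraphs f =
  trans (length-vecsOver (vecsOver _ f) f) (cong (_^ f) (length-vecsOver (false ∷ true ∷ []) f))

isSimple? : ∀ {f} (G : Graph f) → Dec (IsSimple G)
isSimple? G = all? (λ u → adj G u u ≟ᵇ false) ×-dec all? (λ u → all? λ v → adj G u v ≟ᵇ adj G v u)

module _ {n t f : ℕ} where

  RespectsGraphs : (FlagPair n t f → Poly n) → Set
  RespectsGraphs fam = ∀ p q → T p ≡ T q → F p ≡ F q → fam p ≈ₚ fam q

  -- t ≤ f is irrelevant in gGraph and aboveType, so only T and F matter.
  gPoly-respects : (Θ′ : Fin t → Fin n) → RespectsGraphs (gPoly Θ′)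
  gPoly-respects Θ′ _ _ refl refl a = refl

  dPoly-respects : (Θ′ : Fin t → Fin n) → RespectsGraphs (dPoly Θ′)
  dPoly-respects Θ′ _ _ refl refl a = refl

  labelledPart : .(t ≤ f) → Graph f → Graph t
  labelledPart t≤f G = tabulate λ i → tabulate λ j → adj G (inject≤ i t≤f) (inject≤ j t≤f)

  adj-labelledPart : ∀ .(t≤f : t ≤ f) G i j →
                     adj (labelledPart t≤f G) i j ≡ adj G (inject≤ i t≤f) (inject≤ j t≤f)
  adj-labelledPart t≤f G i j =
    trans (cong (λ row → lookup row j) (lookup∘tabulate _ i)) (lookup∘tabulate _ j)

  flagOf : f ≤ n → t ≤ f → (G : Graph f) → IsSimple G → FlagPair n t f
  flagOf f≤n t≤f G (loopless , symmetric) = record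
    { f≤n      = f≤n
    ; t≤f      = t≤f
    ; T        = labelledPart t≤f G
    ; T-simple = (λ u → trans (adj-labelledPart t≤f G u u) (loopless _)) ,
                 (λ u v → trans (adj-labelledPart t≤f G u v)
                                (trans (symmetric _ _) (≡.sym (adj-labelledPart t≤f G v u))))
    ; F        = G
    ; F-simple = loopless , symmetric
    ; F-labels = λ i j → ≡.sym (adj-labelledPart t≤f G i j)
    }

  flagOf? : Graph f → Maybe (FlagPair n t f)
  flagOf? G with f ≤? n | t ≤? f | isSimple? G
  ... | yes f≤n | yes t≤f | yes simple = just (flagOf f≤n t≤f G simple)
  ... | _       | _       | _          = nothing

  flagOf?-F : ∀ p → MaybeAny.Any (λ q → T p ≡ T q × F p ≡ F q) (flagOf? (F p))
  flagOf?-F p with f ≤? n | t ≤? f | isSimple? (F p)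
  ... | yes f≤n | yes t≤f | yes simple = MaybeAny.just (Graph-ext T≗ , refl)
    where
    T≗ : ∀ i j → adj (T p) i j ≡ adj (labelledPart t≤f (F p)) i j
    T≗ i j = trans (≡.sym (F-labels p i j)) (≡.sym (adj-labelledPart t≤f (F p) i j))
  ... | no f≰n  | _       | _          = contradiction (f≤n p) f≰n
  ... | yes _   | no t≰f  | _          = contradiction (t≤f p) t≰f
  ... | yes _   | yes _   | no ¬simple = contradiction (F-simple p) ¬simple

  sameGraphs⇒≈flag : ∀ {p q : FlagPair n t f} → T p ≡ T q → F p ≡ F q → p ≈flag q
  sameGraphs⇒≈flag T≡ F≡ = T≡ , Permutation.id , (λ _ → refl) , λ u v → cong (λ G → adj G u v) (≡.sym F≡)

  familyAtMost : (fam : FlagPair n t f → Poly n) → RespectsGraphs fam → FamilyAtMost ((2 ^ f) ^ f) fam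
  familyAtMost fam respects = mapMaybe flagOf? (allGraphs f) , length≤ , covers
    where
    length≤ : length (mapMaybe flagOf? (allGraphs f)) ≤ (2 ^ f) ^ f
    length≤ = ≤-trans (length-catMaybes (map flagOf? (allGraphs f)))
                      (≤-reflexive (trans (length-map flagOf? (allGraphs f)) (length-allGraphs f)))
    covers : ∀ p → Any (λ q → p ≈flag q × fam p ≈ₚ fam q) (mapMaybe flagOf? (allGraphs f))
    covers p = mapMaybe⁺ flagOf? (allGraphs f) (Any-map⁺ (lose (∈-allGraphs (F p)) (MaybeAny.map
      (λ {q} (T≡ , F≡) → sameGraphs⇒≈flag {p} {q} T≡ F≡ , respects p q T≡ F≡) (flagOf?-F p))))

FamilyAtMost-mono : ∀ {n t f k k′} {fam : FlagPair n t f → Poly n} →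
                    k ≤ k′ → FamilyAtMost k fam → FamilyAtMost k′ fam
FamilyAtMost-mono k≤k′ (L , L≤k , covers) = L , ≤-trans L≤k k≤k′ , covers

≥lex-head : ∀ {x y xs ys} → (x ∷ xs) ≥lex (y ∷ ys) → y ≤ x
≥lex-head (inj₁ y<x)        = <⇒≤ y<x
≥lex-head (inj₂ (refl , _)) = ≤-refl

firstRow-bound : ∀ {n d lam} → 1 ≤ n → IsPartition n lam → lam ≥lex hookShape n d → (τ : Tableau n lam) →
                 ∃₂ λ r rest → rows τ ≡ r ∷ rest × Unique r × n ≤ 2 * d + length r
firstRow-bound 1≤n (_ , _ , 0≡n) _ record { rows = [] ; shape = refl } =
  contradiction (subst (1 ≤_) (≡.sym 0≡n) 1≤n) λ ()
firstRow-bound {n} {d} _ _ lam≥hook record { rows = r ∷ rest ; shape = refl ; distinct = distinct } =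
  r , rest , refl , Unique-++⁻ˡ r distinct , (begin
    n                   ≤⟨ m≤n+m∸n n (2 * d) ⟩
    2 * d + (n ∸ 2 * d) ≤⟨ +-monoʳ-≤ (2 * d) (≥lex-head lam≥hook) ⟩
    2 * d + length r    ∎)
  where open ≤-Reasoning

bound : ℕ → ℕ
bound d = symBound d + (2 ^ (2 * d)) ^ (2 * d)

flagFamilyAtMost : ∀ {n t} d (fam : FlagPair n t (2 * d) → Poly n) → RespectsGraphs fam →
                   FamilyAtMost (bound d) fam
flagFamilyAtMost d fam respects = FamilyAtMost-mono (m≤n+m _ (symBound d)) (familyAtMost fam respects)

proposition3p21 : Σ (ℕ → ℕ) λ N →
    (∀ d → 1 ≤ d → 1 ≤ N d) ×
    (∀ (n d : ℕ) → 1 ≤ n → 1 ≤ d →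
      (lam : List ℕ) → IsPartition n lam → lam ≥lex hookShape n d →
      (τ : Tableau n lam) →
        SymSetAtMost (N d) (rows τ) d ×
        FamilyAtMost {n} {n ∸ part₁ lam} {2 * d} (N d) (gPoly (Θ τ)) ×
        FamilyAtMost {n} {n ∸ part₁ lam} {2 * d} (N d) (dPoly (Θ τ)))
proposition3p21 =
  bound , (λ d _ → ≤-trans (geometricSum-positive _ d) (m≤m+n _ _)) ,
  λ n d 1≤n _ lam partition lam≥hook τ →
    let r , rest , rows≡ , r-unique , n≤2d+r = firstRow-bound {d = d} 1≤n partition lam≥hook τ
    in subst (λ rs → SymSetAtMost (bound d) rs d) (≡.sym rows≡)
             (SymSetAtMost-mono {rs = r ∷ rest} (m≤m+n _ _) (hookSym-atMost d r rest r-unique n≤2d+r)) ,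
       flagFamilyAtMost d (gPoly (Θ τ)) (gPoly-respects (Θ τ)) ,
       flagFamilyAtMost d (dPoly (Θ τ)) (dPoly-respects (Θ τ))
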